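{- Let $k\ge1$, $n\in\mathbb{N}$ and $\alpha=(\alpha_1,\dots,\alpha_k)\in\mathbb{N}_0^k$ with $\alpha_1\ge\dots\ge\alpha_k$. The set $\Delta^{(1^k)}P_{k,n,\alpha}:=\{A\in P_{k,n,\alpha}: a_{k,1}=0\}$ is a facet of the polytope $P_{k,n,\alpha}$.
   Context: A partial matrix $A=(a_{ij})$ has real entries indexed by $1\le i\le k$, $1\le j\le k-i+1$, viewed as a point of $\mathbb{R}^{\binom{k+1}{2}}$. $P_{k,n,\alpha}$ is the convex polytope of partial matrices with $0\le a_{ij}\le n+\alpha_{i+j-1}$ for all $i,j$; $\sum_{j=1}^{m}a_{ij}\le\sum_{j=1}^{m}a_{(i-1)j}$ for all $2\le i\le k$, $1\le m\le k-i+1$; and $\sum_{i=1}^{m}a_{i,m+1-i}=n+\alpha_m$ for $1\le m\le k$. A facet is a face of codimension one.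
   Formalization: The partial matrices in $P_{k,n,\alpha}$ have rational rather than real entries, and the supporting hyperplanes and affine independence defining faces and facets are taken over ℚ. -}

module Defs where

open import Level using (0ℓ)
open import Data.Nat as ℕ using (ℕ; zero; suc)
open import Data.Fin as Fin using (Fin)
open import Data.Integer using (+_)
open import Data.Rational using (ℚ; 0ℚ; _+_; _*_; _≤_; _/_)
open import Data.Product using (Σ; ∃; _×_)
open import Function using (_∘_)
open import Function.Bundles using (_⇔_)
open import Relation.Binary.PropositionalEquality using (_≡_)
open import Relation.Nullary using (¬_)

ℕ→ℚ : ℕ → ℚ
ℕ→ℚ m = + m / 1

sumTo : ℕ → (ℕ → ℚ) → ℚ
sumTo zero    f = 0ℚ
sumTo (suc m) f = sumTo m f + f m

sumFin : ∀ {m} → (Fin m → ℚ) → ℚ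
sumFin {zero}  f = 0ℚ
sumFin {suc m} f = f Fin.zero + sumFin (f ∘ Fin.suc)

-- A point is a (0-based) doubly indexed array of rationals;
-- partial matrices are the points vanishing outside the staircase
-- {(i,j) : i + j < k} (enforced in the definition of P below).
Pt : Set
Pt = ℕ → ℕ → ℚ

Region : Set₁
Region = Pt → Set

dot : ℕ → Pt → Pt → ℚ
dot N c x = sumTo N (λ i → sumTo N (λ j → c i j * x i j))

AffIndep : ∀ {m} → (Fin m → Pt) → Set
AffIndep {m} ps =
  ∀ (c : Fin m → ℚ) → sumFin c ≡ 0ℚ →
  (∀ i j → sumFin (λ t → c t * ps t i j) ≡ 0ℚ) →
  ∀ t → c t ≡ 0ℚ

-- S has affine dimension r - 1 (r = maximal number of affinely independent
-- points of S; r = 0 iff S is empty, i.e. dim ∅ = -1)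
HasRank : Region → ℕ → Set
HasRank S r =
  (Σ (Fin r → Pt) λ ps → (∀ t → S (ps t)) × AffIndep ps) ×
  (∀ (ps : Fin (suc r) → Pt) → (∀ t → S (ps t)) → ¬ AffIndep ps)

IsFace : Region → Region → Set
IsFace P F =
  Σ ℕ λ N → Σ Pt λ c → Σ ℚ λ b →
    (∀ x → P x → dot N c x ≤ b) ×
    (∀ x → F x ⇔ (P x × dot N c x ≡ b))

IsFacet : Region → Region → Set
IsFacet P F = IsFace P F × (Σ ℕ λ r → HasRank P (suc r) × HasRank F r)

-- α as a function of a 0-based index (value irrelevant beyond k)
at : ∀ {k} → (Fin k → ℕ) → ℕ → ℕ
at {zero}  α m       = 0
at {suc k} α zero    = α Fin.zero
at {suc k} α (suc m) = at (α ∘ Fin.suc) m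

Antitone : ∀ {k} → (Fin k → ℕ) → Set
Antitone {k} α = ∀ (i j : Fin k) → i Fin.≤ j → α j ℕ.≤ α i

rowSum : Pt → ℕ → ℕ → ℚ
rowSum a i m = sumTo m (λ j → a i j)

diagSum : Pt → ℕ → ℚ
diagSum a m = sumTo (suc m) (λ i → a i (m ℕ.∸ i))

-- The polytope P_{k,n,α}, with 0-based indices:
-- entry (i,j) here is a_{(i+1)(j+1)} of the paper, α_{m+1} is `at α m`.
P : (k n : ℕ) → (Fin k → ℕ) → Region
P k n α a =
  (∀ i j → k ℕ.≤ i ℕ.+ j → a i j ≡ 0ℚ) ×
  (∀ i j → i ℕ.+ j ℕ.< k → (0ℚ ≤ a i j) × (a i j ≤ ℕ→ℚ (n ℕ.+ at α (i ℕ.+ j)))) ×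
  (∀ i m → suc i ℕ.+ m ℕ.≤ k → rowSum a (suc i) m ≤ rowSum a i m) ×
  (∀ m → m ℕ.< k → diagSum a m ≡ ℕ→ℚ (n ℕ.+ at α m))

ΔP : (k n : ℕ) → (Fin k → ℕ) → Region
ΔP k n α a = P k n α a × (a (k ℕ.∸ 1) 0 ≡ 0ℚ)

module Submission where

-- Face.  a_{k,1} ≥ 0 holds on P, so the functional A ↦ -a_{k,1} is ≤ 0 on P
-- and ΔP is exactly where it vanishes (`corner-face`).
--
-- Call an entry (p , q) with p ≥ 1 inside the staircase free.
-- * Upper bound: an affine relation among points of P that vanishes on the
--   free entries vanishes everywhere, because row 0 is fixed by the
--   antidiagonal sums (`determined-by-free`).  Hence more than 1 + #free points
--   are dependent, by Gaussian elimination (`more-vectors-than-coordinates`);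
--   on ΔP the corner entry is also forced, leaving one free entry fewer.
-- * Lower bound: the base point (all mass in row 0) and, for every free
--   entry (p , q), the point with a chain of ones at (1 , q), …, (p , q)
--   (compensated in row 0) lie in P and are affinely independent, since
--   differences of consecutive rows isolate the end of each chain
--   (`chains-independent`).  All chains except the one ending at the corner
--   lie in ΔP.
-- So dim P = #free and dim ΔP = #free - 1 (for k = 1: P is a point, ΔP = ∅).

open import Defs

open import Algebra.Bundles using (CommutativeRing)
open import Data.Bool using (if_then_else_)
open import Data.Empty using (⊥-elim)
open import Data.Fin as Fin using (Fin; punchIn)
open import Data.Fin.Patterns using (0F)
import Data.Fin.Properties as FinP
import Data.Integer as ℤ
import Data.Integer.Properties as ℤP
open import Data.List using (List; []; _∷_; length; lookup; map; filter; cartesianProduct; upTo)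
open import Data.List.Membership.Propositional using (_∈_)
open import Data.List.Membership.Propositional.Properties
  using (∈-map⁺; ∈-lookup; ∈-filter⁺; ∈-filter⁻; ∈-cartesianProduct⁺; ∈-upTo⁺)
import Data.List.Properties as ListP
open import Data.List.Relation.Unary.All as All using (All; []; _∷_)
open import Data.List.Relation.Unary.Any using (here; there)
open import Data.List.Relation.Unary.AllPairs using ([]; _∷_)
open import Data.List.Relation.Unary.Unique.Propositional using (Unique)
import Data.List.Relation.Unary.Unique.Propositional.Properties as UniqueP
open import Data.Maybe using (Maybe; nothing; just)
open import Data.Nat as ℕ using (ℕ; zero; suc; z≤n; s≤s; _∸_; _<_; _<?_; _≤?_)
import Data.Nat.Coprimality as Coprime
import Data.Nat.Properties as ℕP
open import Data.Product using (_×_; _,_; proj₁; proj₂)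
open import Data.Product.Properties using (≡-dec)
open import Data.Rational as ℚ using (ℚ; 0ℚ; 1ℚ; mkℚ; _+_; _*_; -_; _-_; _≤_)
import Data.Rational.Properties as ℚP
open import Data.Rational.Solver using (module +-*-Solver)
open import Data.Vec.Functional using (insertAt)
open import Data.Vec.Functional.Properties using (insertAt-lookup; insertAt-punchIn)
open import Data.Sum using (_⊎_; inj₁; inj₂)
open import Function using (_∘_)
open import Function.Bundles using (_⇔_; mk⇔)
open import Relation.Binary.Definitions using (DecidableEquality; tri<; tri≈; tri>)
open import Relation.Binary.PropositionalEquality
open import Relation.Nullary using (¬_; Dec; yes; no; does; ¬?)
open import Relation.Nullary.Decidable using (dec-true; dec-false; _×-dec_)
open import Relation.Unary using (_⊆_)

open import Algebra.Properties.Semiring.Sum (CommutativeRing.semiring ℚP.+-*-commutativeRing)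
  using (sum; sum-cong-≗; sum-replicate-zero; sum-remove; ∑-distrib-+; *-distribʳ-sum)

open +-*-Solver using (solve; _:+_; _:*_; :-_; _:-_; _:=_)

ℕ→ℚ-normal : ∀ m → ℕ→ℚ m ≡ mkℚ (ℤ.+ m) 0 (Coprime.sym (Coprime.1-coprimeTo m))
ℕ→ℚ-normal m = ℚP.normalize-coprime (Coprime.sym (Coprime.1-coprimeTo m))

ℕ→ℚ-+ : ∀ a b → ℕ→ℚ (a ℕ.+ b) ≡ ℕ→ℚ a + ℕ→ℚ b
ℕ→ℚ-+ a b rewrite ℕ→ℚ-normal a | ℕ→ℚ-normal b =
  ℚP./-cong {p₁ = ℤ.+ (a ℕ.+ b)}
    (sym (cong₂ ℤ._+_ (ℤP.*-identityʳ (ℤ.+ a)) (ℤP.*-identityʳ (ℤ.+ b)))) refl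

ℕ→ℚ-mono-≤ : ∀ {a b} → a ℕ.≤ b → ℕ→ℚ a ≤ ℕ→ℚ b
ℕ→ℚ-mono-≤ {a} {b} a≤b rewrite ℕ→ℚ-normal a | ℕ→ℚ-normal b =
  ℚ.*≤* (subst₂ ℤ._≤_ (sym (ℤP.*-identityʳ (ℤ.+ a))) (sym (ℤP.*-identityʳ (ℤ.+ b)))
           (ℤ.+≤+ a≤b))

ℕ→ℚ-injective : ∀ {a b} → ℕ→ℚ a ≡ ℕ→ℚ b → a ≡ b
ℕ→ℚ-injective {a} {b} eq rewrite ℕ→ℚ-normal a | ℕ→ℚ-normal b =
  ℤP.+-injective (cong ℚ.ℚ.numerator eq)

-- Sums over Fin.  Defs uses its own `sumFin`; we work with the library's
-- `sum` (same recursion) to have its algebraic laws at hand.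
sumFin≡sum : ∀ {m} (f : Fin m → ℚ) → sumFin f ≡ sum f
sumFin≡sum {zero}  f = refl
sumFin≡sum {suc m} f = cong (f 0F +_) (sumFin≡sum (f ∘ Fin.suc))

sum-zero : ∀ {m} {f : Fin m → ℚ} → (∀ t → f t ≡ 0ℚ) → sum f ≡ 0ℚ
sum-zero {m} f≗0 = trans (sum-cong-≗ f≗0) (sum-replicate-zero m)

sum-single : ∀ {m} (f : Fin (suc m) → ℚ) i → (∀ t → t ≢ i → f t ≡ 0ℚ) → sum f ≡ f i
sum-single f i others = begin
  sum f                            ≡⟨ sum-remove {i = i} f ⟩
  f i + sum (f ∘ punchIn i)        ≡⟨ cong (f i +_) (sum-zero (λ u → others _ (FinP.punchInᵢ≢i i u))) ⟩
  f i + 0ℚ                         ≡⟨ ℚP.+-identityʳ (f i) ⟩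
  f i                              ∎
  where open ≡-Reasoning

sumTo-zero : ∀ m {f : ℕ → ℚ} → (∀ i → i < m → f i ≡ 0ℚ) → sumTo m f ≡ 0ℚ
sumTo-zero zero    f≗0 = refl
sumTo-zero (suc m) f≗0 =
  cong₂ _+_ (sumTo-zero m (λ i i<m → f≗0 i (ℕP.m<n⇒m<1+n i<m))) (f≗0 m ℕP.≤-refl)

sumTo-single : ∀ m {f : ℕ → ℚ} a → a < m → (∀ i → i < m → i ≢ a → f i ≡ 0ℚ) → sumTo m f ≡ f a
sumTo-single (suc m) {f} a a<1+m others with a ℕ.≟ m
... | yes refl = begin
  sumTo a f + f a ≡⟨ cong (_+ f a) (sumTo-zero a (λ i i<a → others i (ℕP.m<n⇒m<1+n i<a) (ℕP.<⇒≢ i<a))) ⟩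
  0ℚ + f a        ≡⟨ ℚP.+-identityˡ (f a) ⟩
  f a             ∎
  where open ≡-Reasoning
... | no a≢m = begin
  sumTo m f + f m ≡⟨ cong₂ _+_ (sumTo-single m a a<m (λ i i<m → others i (ℕP.m<n⇒m<1+n i<m)))
                               (others m ℕP.≤-refl (a≢m ∘ sym)) ⟩
  f a + 0ℚ        ≡⟨ ℚP.+-identityʳ (f a) ⟩
  f a             ∎
  where
    open ≡-Reasoning
    a<m : a < m
    a<m = ℕP.≤∧≢⇒< (ℕP.≤-pred a<1+m) a≢m

sumTo-shift : ∀ m (f : ℕ → ℚ) → sumTo (suc m) f ≡ f 0 + sumTo m (f ∘ suc)
sumTo-shift zero    f = ℚP.+-comm 0ℚ (f 0)
sumTo-shift (suc m) f = begin
  sumTo (suc m) f + f (suc m)             ≡⟨ cong (_+ f (suc m)) (sumTo-shift m f) ⟩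
  f 0 + sumTo m (f ∘ suc) + f (suc m)     ≡⟨ ℚP.+-assoc (f 0) (sumTo m (f ∘ suc)) (f (suc m)) ⟩
  f 0 + sumTo (suc m) (f ∘ suc)           ∎
  where open ≡-Reasoning

sumTo-nonneg : ∀ m {f : ℕ → ℚ} → (∀ i → 0ℚ ≤ f i) → 0ℚ ≤ sumTo m f
sumTo-nonneg zero    f≥0 = ℚP.≤-refl
sumTo-nonneg (suc m) f≥0 = ℚP.+-mono-≤ (sumTo-nonneg m f≥0) (f≥0 m)

sumTo-head≤ : ∀ m {f : ℕ → ℚ} → (∀ i → 0ℚ ≤ f i) → f 0 ≤ sumTo (suc m) f
sumTo-head≤ m {f} f≥0 = subst₂ _≤_ (ℚP.+-identityʳ (f 0)) (sym (sumTo-shift m f))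
  (ℚP.+-monoʳ-≤ (f 0) (sumTo-nonneg m (f≥0 ∘ suc)))

sum-sumTo-comm : ∀ {s} (c : Fin s → ℚ) N (f : Fin s → ℕ → ℚ) →
  sum (λ t → c t * sumTo N (f t)) ≡ sumTo N (λ i → sum (λ t → c t * f t i))
sum-sumTo-comm c zero    f = sum-zero (λ t → ℚP.*-zeroʳ (c t))
sum-sumTo-comm c (suc N) f = begin
  sum (λ t → c t * (sumTo N (f t) + f t N))
    ≡⟨ sum-cong-≗ (λ t → ℚP.*-distribˡ-+ (c t) (sumTo N (f t)) (f t N)) ⟩
  sum (λ t → c t * sumTo N (f t) + c t * f t N)
    ≡⟨ ∑-distrib-+ (λ t → c t * sumTo N (f t)) (λ t → c t * f t N) ⟩
  sum (λ t → c t * sumTo N (f t)) + sum (λ t → c t * f t N)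
    ≡⟨ cong (_+ sum (λ t → c t * f t N)) (sum-sumTo-comm c N f) ⟩
  sumTo N (λ i → sum (λ t → c t * f t i)) + sum (λ t → c t * f t N) ∎
  where open ≡-Reasoning

module LinearDependence {K : Set} where

  IndependentOn : ∀ {s} → List K → (Fin s → K → ℚ) → Set
  IndependentOn {s} L v =
    ∀ (c : Fin s → ℚ) → (∀ x → x ∈ L → sum (λ t → c t * v t x) ≡ 0ℚ) → ∀ t → c t ≡ 0ℚ

  drop-zero-coordinate : ∀ {s} {key L} (v : Fin s → K → ℚ) → (∀ t → v t key ≡ 0ℚ) →
    IndependentOn (key ∷ L) v → IndependentOn L v
  drop-zero-coordinate v column≡0 indep c onL = indep c onKeyL
    where
      onKeyL : ∀ x → x ∈ _ ∷ _ → sum (λ t → c t * v t x) ≡ 0ℚ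
      onKeyL x (here refl) = sum-zero (λ t → trans (cong (c t *_) (column≡0 t)) (ℚP.*-zeroʳ (c t)))
      onKeyL x (there x∈L) = onL x x∈L

  module Elimination {s} (v : Fin (suc s) → K → ℚ) (t₀ : Fin (suc s)) (key : K)
                     (pivot≢0 : v t₀ key ≢ 0ℚ) where

    instance
      pivot-nonZero : ℚ.NonZero (v t₀ key)
      pivot-nonZero = ℚ.≢-nonZero pivot≢0

    ratio : Fin s → ℚ
    ratio u = v (punchIn t₀ u) key * ℚ.1/ (v t₀ key)

    reduced : Fin s → K → ℚ
    reduced u x = v (punchIn t₀ u) x - ratio u * v t₀ x

    reduced-key : ∀ u → reduced u key ≡ 0ℚ
    reduced-key u = begin
      V - ratio u * v t₀ key   ≡⟨ cong (_-_ V) (ℚP.*-assoc V (ℚ.1/ v t₀ key) (v t₀ key)) ⟩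
      V - V * (ℚ.1/ v t₀ key * v t₀ key) ≡⟨ cong (λ z → V - V * z) (ℚP.*-inverseˡ (v t₀ key)) ⟩
      V - V * 1ℚ               ≡⟨ cong (_-_ V) (ℚP.*-identityʳ V) ⟩
      V - V                    ≡⟨ ℚP.+-inverseʳ V ⟩
      0ℚ                       ∎
      where
        open ≡-Reasoning
        V = v (punchIn t₀ u) key

    lift : (Fin s → ℚ) → Fin (suc s) → ℚ
    lift c' = insertAt c' t₀ (sum (λ u → - (c' u * ratio u)))

    lift-combination : ∀ c' x → sum (λ t → lift c' t * v t x) ≡ sum (λ u → c' u * reduced u x)
    lift-combination c' x = begin
      sum (λ t → lift c' t * v t x)
        ≡⟨ sum-remove {i = t₀} (λ t → lift c' t * v t x) ⟩
      lift c' t₀ * Z + sum (λ u → lift c' (punchIn t₀ u) * v (punchIn t₀ u) x)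
        ≡⟨ cong₂ _+_ (cong (_* Z) (insertAt-lookup c' t₀ _))
                     (sum-cong-≗ (λ u → cong (_* v (punchIn t₀ u) x) (insertAt-punchIn c' t₀ _ u))) ⟩
      sum (λ u → - (c' u * ratio u)) * Z + sum (λ u → c' u * v (punchIn t₀ u) x)
        ≡⟨ cong (_+ sum (λ u → c' u * v (punchIn t₀ u) x)) (*-distribʳ-sum Z (λ u → - (c' u * ratio u))) ⟩
      sum (λ u → - (c' u * ratio u) * Z) + sum (λ u → c' u * v (punchIn t₀ u) x)
        ≡⟨ ∑-distrib-+ (λ u → - (c' u * ratio u) * Z) (λ u → c' u * v (punchIn t₀ u) x) ⟨
      sum (λ u → - (c' u * ratio u) * Z + c' u * v (punchIn t₀ u) x)
        ≡⟨ sum-cong-≗ (λ u → solve 4 (λ c r z w → (:- (c :* r)) :* z :+ c :* w := c :* (w :- r :* z))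
                                     refl (c' u) (ratio u) Z (v (punchIn t₀ u) x)) ⟩
      sum (λ u → c' u * reduced u x) ∎
      where
        open ≡-Reasoning
        Z = v t₀ x

    reduced-independent : ∀ {L} → IndependentOn (key ∷ L) v → IndependentOn L reduced
    reduced-independent indep c' onL u =
      trans (sym (insertAt-punchIn c' t₀ _ u)) (indep (lift c') onKeyL (punchIn t₀ u))
      where
        onKeyL : ∀ x → x ∈ key ∷ _ → sum (λ t → lift c' t * v t x) ≡ 0ℚ
        onKeyL x (here refl) = trans (lift-combination c' x)
          (sum-zero (λ u → trans (cong (c' u *_) (reduced-key u)) (ℚP.*-zeroʳ (c' u))))
        onKeyL x (there x∈L) = trans (lift-combination c' x) (onL x x∈L)

  -- Induction on L: a zero column is dropped, otherwise one elimination step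
  -- removes a vector and a coordinate.  With no coordinates left, any nonzero
  -- c is a relation.
  more-vectors-than-coordinates : ∀ (L : List K) {s} (v : Fin s → K → ℚ) →
    length L < s → ¬ IndependentOn L v
  more-vectors-than-coordinates [] {suc s} v _ indep = ℚP.1≢0 (indep (λ _ → 1ℚ) (λ _ ()) 0F)
  more-vectors-than-coordinates (key ∷ L) {suc s} v (s≤s |L|<s) indep
    with FinP.any? (λ t → ¬? (v t key ℚP.≟ 0ℚ))
  ... | no noPivot = more-vectors-than-coordinates L v (ℕP.m<n⇒m<1+n |L|<s)
                       (drop-zero-coordinate v column≡0 indep)
    where
      column≡0 : ∀ t → v t key ≡ 0ℚ
      column≡0 t with v t key ℚP.≟ 0ℚ
      ... | yes vt≡0 = vt≡0
      ... | no vt≢0 = ⊥-elim (noPivot (t , vt≢0))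
  ... | yes (t₀ , pivot≢0) = more-vectors-than-coordinates L reduced |L|<s (reduced-independent indep)
    where open Elimination v t₀ key pivot≢0

open LinearDependence

combination : ∀ {s} → (Fin s → ℚ) → (Fin s → Pt) → Pt
combination c ps i j = sum (λ t → c t * ps t i j)

combination-zero : ∀ {s} (c : Fin s → ℚ) (ps : Fin s → Pt) i j →
  (∀ t → ps t i j ≡ 0ℚ) → combination c ps i j ≡ 0ℚ
combination-zero c ps i j ps≡0 = sum-zero (λ t → trans (cong (c t *_) (ps≡0 t)) (ℚP.*-zeroʳ (c t)))

AffIndep-sum : ∀ {s} → (Fin s → Pt) → Set
AffIndep-sum {s} ps = ∀ (c : Fin s → ℚ) → sum c ≡ 0ℚ →
  (∀ i j → combination c ps i j ≡ 0ℚ) → ∀ t → c t ≡ 0ℚ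

AffIndep→sum : ∀ {s} (ps : Fin s → Pt) → AffIndep ps → AffIndep-sum ps
AffIndep→sum ps indep c Σc≡0 comb≡0 =
  indep c (trans (sumFin≡sum c) Σc≡0) (λ i j → trans (sumFin≡sum (λ t → c t * ps t i j)) (comb≡0 i j))

sum→AffIndep : ∀ {s} (ps : Fin s → Pt) → AffIndep-sum ps → AffIndep ps
sum→AffIndep ps indep c Σc≡0 comb≡0 =
  indep c (trans (sym (sumFin≡sum c)) Σc≡0) (λ i j → trans (sym (sumFin≡sum (λ t → c t * ps t i j))) (comb≡0 i j))

-- An affine relation among points of P which vanishes on the free
-- coordinates (row ≥ 1, inside the staircase) vanishes everywhere: entries
-- outside the staircase are 0, and row 0 is fixed by the antidiagonal sums.
determined-by-free : ∀ k n α {s} (ps : Fin s → Pt) → (∀ t → P k n α (ps t)) →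
  (c : Fin s → ℚ) → sum c ≡ 0ℚ →
  (∀ p q → 1 ℕ.≤ p → p ℕ.+ q < k → combination c ps p q ≡ 0ℚ) →
  ∀ i j → combination c ps i j ≡ 0ℚ
determined-by-free k n α ps inP c Σc≡0 free≡0 i j with k ℕ.≤? i ℕ.+ j
... | yes outside = combination-zero c ps i j (λ t → proj₁ (inP t) i j outside)
determined-by-free k n α ps inP c Σc≡0 free≡0 (suc i) j | no inside =
  free≡0 (suc i) j (s≤s z≤n) (ℕP.≰⇒> inside)
determined-by-free k n α ps inP c Σc≡0 free≡0 zero j | no inside = begin
  combination c ps 0 j                               ≡⟨ sumTo-single (suc j) 0 (s≤s z≤n) lower-rows ⟨
  sumTo (suc j) (λ i → combination c ps i (j ∸ i))   ≡⟨ sum-sumTo-comm c (suc j) (λ t i → ps t i (j ∸ i)) ⟨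
  sum (λ t → c t * diagSum (ps t) j)                 ≡⟨ sum-cong-≗ (λ t → cong (c t *_) (diagonal t)) ⟩
  sum (λ t → c t * ℕ→ℚ (n ℕ.+ at α j))               ≡⟨ *-distribʳ-sum (ℕ→ℚ (n ℕ.+ at α j)) c ⟨
  sum c * ℕ→ℚ (n ℕ.+ at α j)                         ≡⟨ cong (_* ℕ→ℚ (n ℕ.+ at α j)) Σc≡0 ⟩
  0ℚ * ℕ→ℚ (n ℕ.+ at α j)                            ≡⟨ ℚP.*-zeroˡ (ℕ→ℚ (n ℕ.+ at α j)) ⟩
  0ℚ                                                 ∎
  where
    open ≡-Reasoning
    j<k : j < k
    j<k = ℕP.≰⇒> inside
    diagonal : ∀ t → diagSum (ps t) j ≡ ℕ→ℚ (n ℕ.+ at α j)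
    diagonal t = proj₂ (proj₂ (proj₂ (inP t))) j j<k
    lower-rows : ∀ i → i < suc j → i ≢ 0 → combination c ps i (j ∸ i) ≡ 0ℚ
    lower-rows zero    _     0≢0 = ⊥-elim (0≢0 refl)
    lower-rows (suc i) i<1+j _   = free≡0 (suc i) (j ∸ suc i) (s≤s z≤n)
      (subst (_< k) (sym (ℕP.m+[n∸m]≡n (ℕP.≤-pred i<1+j))) j<k)

Covers : ℕ → Region → List (ℕ × ℕ) → Set
Covers k S L = ∀ p q → 1 ℕ.≤ p → p ℕ.+ q < k → (p , q) ∈ L ⊎ (∀ x → S x → x p q ≡ 0ℚ)

-- The points viewed as vectors: the constant coordinate `nothing` detects
-- Σ cₜ, the coordinate `just (p , q)` the entry (p , q).
as-vectors : ∀ {s} → (Fin s → Pt) → Fin s → Maybe (ℕ × ℕ) → ℚ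
as-vectors ps t nothing        = 1ℚ
as-vectors ps t (just (p , q)) = ps t p q

affinely-dependent : ∀ k n α (S : Region) → S ⊆ P k n α → (L : List (ℕ × ℕ)) → Covers k S L →
  ∀ {s} → suc (length L) < s → (ps : Fin s → Pt) → (∀ t → S (ps t)) → ¬ AffIndep ps
affinely-dependent k n α S S⊆P L covers {s} |L|<s ps inS indep =
  more-vectors-than-coordinates (nothing ∷ map just L) (as-vectors ps) enough-vectors independent
  where
    enough-vectors : length (nothing ∷ map just L) < s
    enough-vectors = subst (λ l → suc l < s) (sym (ListP.length-map just L)) |L|<s

    independent : IndependentOn (nothing ∷ map just L) (as-vectors ps)
    independent c onCoordinates =
      AffIndep→sum ps indep c Σc≡0 (determined-by-free k n α ps (S⊆P ∘ inS) c Σc≡0 free≡0)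
      where
        Σc≡0 : sum c ≡ 0ℚ
        Σc≡0 = trans (sum-cong-≗ (λ t → sym (ℚP.*-identityʳ (c t)))) (onCoordinates nothing (here refl))
        free≡0 : ∀ p q → 1 ℕ.≤ p → p ℕ.+ q < k → combination c ps p q ≡ 0ℚ
        free≡0 p q 1≤p inside with covers p q 1≤p inside
        ... | inj₁ listed    = onCoordinates (just (p , q)) (there (∈-map⁺ just listed))
        ... | inj₂ vanishing = combination-zero c ps p q (λ t → vanishing (ps t) (inS t))

𝟙 : ∀ {A : Set} → Dec A → ℕ
𝟙 d = if does d then 1 else 0

𝟙-yes : ∀ {A : Set} (d : Dec A) → A → 𝟙 d ≡ 1
𝟙-yes d a rewrite dec-true d a = refl

𝟙-no : ∀ {A : Set} (d : Dec A) → ¬ A → 𝟙 d ≡ 0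
𝟙-no d ¬a rewrite dec-false d ¬a = refl

𝟙≤1 : ∀ {A : Set} (d : Dec A) → 𝟙 d ℕ.≤ 1
𝟙≤1 (yes _) = ℕP.≤-refl
𝟙≤1 (no _)  = z≤n

𝟙*≤ : ∀ {A : Set} (d : Dec A) m → 𝟙 d ℕ.* m ℕ.≤ m
𝟙*≤ d m = subst (𝟙 d ℕ.* m ℕ.≤_) (ℕP.*-identityˡ m) (ℕP.*-monoˡ-≤ m (𝟙≤1 d))

𝟙-mono : ∀ {A B : Set} (a : Dec A) (b : Dec B) → (A → B) → 𝟙 a ℕ.≤ 𝟙 b
𝟙-mono (no _)  b A→B = z≤n
𝟙-mono (yes x) b A→B = ℕP.≤-reflexive (sym (𝟙-yes b (A→B x)))

𝟙-cong : ∀ {A B : Set} (a : Dec A) (b : Dec B) → (A → B) → (B → A) → 𝟙 a ≡ 𝟙 b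
𝟙-cong a b A→B B→A = ℕP.≤-antisym (𝟙-mono a b A→B) (𝟙-mono b a B→A)

𝟙-× : ∀ {A B : Set} (a : Dec A) (b : Dec B) → 𝟙 (a ×-dec b) ≡ 𝟙 a ℕ.* 𝟙 b
𝟙-× (yes _) b = sym (ℕP.*-identityˡ (𝟙 b))
𝟙-× (no _)  b = refl

𝟙-<-step : ∀ i p → 𝟙 (i <? p) ≡ 𝟙 (suc i <? p) ℕ.+ 𝟙 (p ℕ.≟ suc i)
𝟙-<-step i p with ℕP.<-cmp (suc i) p
... | tri< 1+i<p 1+i≢p _
  rewrite 𝟙-yes (i <? p) (ℕP.<⇒≤ 1+i<p) | 𝟙-yes (suc i <? p) 1+i<p | 𝟙-no (p ℕ.≟ suc i) (1+i≢p ∘ sym) = refl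
... | tri≈ _ 1+i≡p _
  rewrite 𝟙-yes (i <? p) (ℕP.≤-reflexive 1+i≡p) | 𝟙-no (suc i <? p) (ℕP.<-irrefl 1+i≡p)
        | 𝟙-yes (p ℕ.≟ suc i) (sym 1+i≡p) = refl
... | tri> 1+i≮p 1+i≢p p<1+i
  rewrite 𝟙-no (i <? p) (ℕP.<⇒≱ p<1+i) | 𝟙-no (suc i <? p) 1+i≮p | 𝟙-no (p ℕ.≟ suc i) (1+i≢p ∘ sym) = refl

_≟₂_ : (x y : ℕ × ℕ) → Dec (x ≡ y)
_≟₂_ = ≡-dec ℕ._≟_ ℕ._≟_

lookup-injective : ∀ {A : Set} {xs : List A} → Unique xs → ∀ t u → lookup xs t ≡ lookup xs u → t ≡ u
lookup-injective (_ ∷ _)            0F       0F       _  = refl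
lookup-injective (x≢xs ∷ _)         0F       (Fin.suc u) eq = ⊥-elim (All.lookup x≢xs (∈-lookup u) eq)
lookup-injective (x≢xs ∷ _)         (Fin.suc t) 0F    eq = ⊥-elim (All.lookup x≢xs (∈-lookup t) (sym eq))
lookup-injective (_ ∷ unique)       (Fin.suc t) (Fin.suc u) eq = cong Fin.suc (lookup-injective unique t u eq)

sum-marker : ∀ {A : Set} (_≟_ : DecidableEquality A) {s} (K : Fin s → A) (c : Fin s → ℚ) v →
  (∀ t → K t ≡ K v → t ≡ v) → sum (λ t → c t * ℕ→ℚ (𝟙 (K t ≟ K v))) ≡ c v
sum-marker _≟_ {suc s} K c v only-at-v = begin
  sum (λ t → c t * ℕ→ℚ (𝟙 (K t ≟ K v)))  ≡⟨ sum-single (λ t → c t * ℕ→ℚ (𝟙 (K t ≟ K v))) v elsewhere ⟩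
  c v * ℕ→ℚ (𝟙 (K v ≟ K v))              ≡⟨ cong (λ b → c v * ℕ→ℚ b) (𝟙-yes (K v ≟ K v) refl) ⟩
  c v * 1ℚ                               ≡⟨ ℚP.*-identityʳ (c v) ⟩
  c v                                    ∎
  where
    open ≡-Reasoning
    elsewhere : ∀ t → t ≢ v → c t * ℕ→ℚ (𝟙 (K t ≟ K v)) ≡ 0ℚ
    elsewhere t t≢v = trans (cong (λ b → c t * ℕ→ℚ b) (𝟙-no (K t ≟ K v) (t≢v ∘ only-at-v t)))
                            (ℚP.*-zeroʳ (c t))

-- For a free coordinate (p , q) the point `chain p q` has
-- ones at (1 , q), …, (p , q) — a chain, so the row-prefix inequalities hold —
-- and row 0 equal to n + α_j, lowered by one on the antidiagonals q+1, …, q+p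
-- that the chain meets, so that all antidiagonal sums are n + α_m.
-- `chain 0 0` is the base point with everything in row 0.
module ChainPoints (k n : ℕ) (α : Fin k → ℕ) where

  compensation : ℕ → ℕ → ℕ → ℕ
  compensation p q j = 𝟙 (q <? j ×-dec j ≤? q ℕ.+ p)

  chainℕ : ℕ → ℕ → ℕ → ℕ → ℕ
  chainℕ p q zero    j = 𝟙 (j <? k) ℕ.* (n ℕ.+ at α j ∸ compensation p q j)
  chainℕ p q (suc i) j = 𝟙 (i <? p ×-dec j ℕ.≟ q)

  chain : ℕ → ℕ → Pt
  chain p q i j = ℕ→ℚ (chainℕ p q i j)

  chain-outside : ∀ p q i j → p ℕ.+ q < k → k ℕ.≤ i ℕ.+ j → chainℕ p q i j ≡ 0
  chain-outside p q zero    j p+q<k k≤j = cong (ℕ._* (n ℕ.+ at α j ∸ compensation p q j)) (𝟙-no (j <? k) (ℕP.≤⇒≯ k≤j))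
  chain-outside p q (suc i) j p+q<k k≤1+i+j = 𝟙-no (i <? p ×-dec j ℕ.≟ q) on-chain
    where
      on-chain : ¬ (i < p × j ≡ q)
      on-chain (i<p , refl) = ℕP.<⇒≱ (ℕP.≤-<-trans (ℕP.+-monoˡ-≤ j i<p) p+q<k) k≤1+i+j

  chain-bound : 1 ℕ.≤ n → ∀ p q i j → chainℕ p q i j ℕ.≤ n ℕ.+ at α (i ℕ.+ j)
  chain-bound 1≤n p q zero    j = ℕP.≤-trans (𝟙*≤ (j <? k) _) (ℕP.m∸n≤m _ (compensation p q j))
  chain-bound 1≤n p q (suc i) j = ℕP.≤-trans (𝟙≤1 (i <? p ×-dec j ℕ.≟ q)) (ℕP.≤-trans 1≤n (ℕP.m≤m+n n _))

  chain-origin : 0 < k → ∀ p q → chainℕ p q 0 0 ≡ n ℕ.+ at α 0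
  chain-origin 0<k p q
    rewrite 𝟙-yes (0 <? k) 0<k | 𝟙-no (q <? 0 ×-dec 0 ≤? q ℕ.+ p) (λ ()) = ℕP.*-identityˡ _

  chain-row : ∀ p q i m → rowSum (chain p q) (suc i) m ≡ ℕ→ℚ (𝟙 (i <? p ×-dec q <? m))
  chain-row p q i m with i <? p ×-dec q <? m
  ... | yes (i<p , q<m) = begin
    rowSum (chain p q) (suc i) m                 ≡⟨ sumTo-single m q q<m off-chain ⟩
    ℕ→ℚ (𝟙 (i <? p ×-dec q ℕ.≟ q))              ≡⟨ cong ℕ→ℚ (𝟙-yes (i <? p ×-dec q ℕ.≟ q) (i<p , refl)) ⟩
    ℕ→ℚ 1                                        ≡⟨ cong ℕ→ℚ (𝟙-yes (i <? p ×-dec q <? m) (i<p , q<m)) ⟨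
    ℕ→ℚ (𝟙 (i <? p ×-dec q <? m))                ∎
    where
      open ≡-Reasoning
      off-chain : ∀ j → j < m → j ≢ q → chain p q (suc i) j ≡ 0ℚ
      off-chain j _ j≢q = cong ℕ→ℚ (𝟙-no (i <? p ×-dec j ℕ.≟ q) (j≢q ∘ proj₂))
  ... | no ¬chain = trans (sumTo-zero m (λ j j<m → cong ℕ→ℚ (𝟙-no (i <? p ×-dec j ℕ.≟ q) (not-met j j<m))))
                          (cong ℕ→ℚ (sym (𝟙-no (i <? p ×-dec q <? m) ¬chain)))
    where
      not-met : ∀ j → j < m → ¬ (i < p × j ≡ q)
      not-met j j<m (i<p , refl) = ¬chain (i<p , j<m)

  chain-rows : 1 ℕ.≤ n → 0 < k → ∀ p q i m → rowSum (chain p q) (suc i) m ≤ rowSum (chain p q) i m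
  chain-rows 1≤n 0<k p q (suc i) m rewrite chain-row p q (suc i) m | chain-row p q i m =
    ℕ→ℚ-mono-≤ (𝟙-mono (suc i <? p ×-dec q <? m) (i <? p ×-dec q <? m) (λ (1+i<p , q<m) → ℕP.<⇒≤ 1+i<p , q<m))
  chain-rows 1≤n 0<k p q zero zero    = ℚP.≤-refl
  chain-rows 1≤n 0<k p q zero (suc m) = begin
    rowSum (chain p q) 1 (suc m)   ≡⟨ chain-row p q 0 (suc m) ⟩
    ℕ→ℚ (𝟙 (0 <? p ×-dec q <? suc m)) ≤⟨ ℕ→ℚ-mono-≤ (ℕP.≤-trans (𝟙≤1 (0 <? p ×-dec q <? suc m)) (ℕP.≤-trans 1≤n (ℕP.m≤m+n n _))) ⟩
    ℕ→ℚ (n ℕ.+ at α 0)            ≡⟨ cong ℕ→ℚ (chain-origin 0<k p q) ⟨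
    chain p q 0 0                  ≤⟨ sumTo-head≤ m (λ j → ℕ→ℚ-mono-≤ {0} {chainℕ p q 0 j} z≤n) ⟩
    rowSum (chain p q) 0 (suc m)   ∎
    where open ℚP.≤-Reasoning

  -- Row i+1 meets antidiagonal m in column m - (i+1); that entry lies on the
  -- chain exactly when m = q + (i+1) with i < p.
  on-antidiagonal : ∀ {i m q} → i < m → m ∸ suc i ≡ q → m ≡ q ℕ.+ suc i
  on-antidiagonal {i} {m} i<m refl = sym (ℕP.m∸n+n≡m i<m)

  chain-crossings : ∀ p q m →
    sumTo m (λ i → chain p q (suc i) (m ∸ suc i)) ≡ ℕ→ℚ (compensation p q m)
  chain-crossings p q m with q <? m ×-dec m ≤? q ℕ.+ p
  ... | yes (q<m , m≤q+p) = begin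
    sumTo m (λ i → chain p q (suc i) (m ∸ suc i))  ≡⟨ sumTo-single m i₀ i₀<m off-chain ⟩
    ℕ→ℚ (𝟙 (i₀ <? p ×-dec m ∸ suc i₀ ℕ.≟ q))       ≡⟨ cong ℕ→ℚ (𝟙-yes (i₀ <? p ×-dec m ∸ suc i₀ ℕ.≟ q) (i₀<p , m-1-i₀≡q)) ⟩
    ℕ→ℚ 1                                          ≡⟨ cong ℕ→ℚ (𝟙-yes (q <? m ×-dec m ≤? q ℕ.+ p) (q<m , m≤q+p)) ⟨
    ℕ→ℚ (compensation p q m)                       ∎
    where
      open ≡-Reasoning
      i₀ : ℕ
      i₀ = m ∸ suc q
      m≡q+1+i₀ : m ≡ q ℕ.+ suc i₀
      m≡q+1+i₀ = trans (sym (ℕP.m+[n∸m]≡n q<m)) (sym (ℕP.+-suc q i₀))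
      i₀<m : i₀ < m
      i₀<m = subst (i₀ <_) (sym m≡q+1+i₀) (ℕP.m≤n+m (suc i₀) q)
      i₀<p : i₀ < p
      i₀<p = ℕP.+-cancelˡ-≤ q _ _ (subst (ℕ._≤ q ℕ.+ p) m≡q+1+i₀ m≤q+p)
      m-1-i₀≡q : m ∸ suc i₀ ≡ q
      m-1-i₀≡q = trans (cong (_∸ suc i₀) m≡q+1+i₀) (ℕP.m+n∸n≡m q (suc i₀))
      off-chain : ∀ i → i < m → i ≢ i₀ → chain p q (suc i) (m ∸ suc i) ≡ 0ℚ
      off-chain i i<m i≢i₀ = cong ℕ→ℚ (𝟙-no (i <? p ×-dec m ∸ suc i ℕ.≟ q) λ (_ , on) →
        i≢i₀ (ℕP.suc-injective (ℕP.+-cancelˡ-≡ q _ _ (trans (sym (on-antidiagonal i<m on)) m≡q+1+i₀))))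
  ... | no ¬crossing = trans (sumTo-zero m (λ i i<m → cong ℕ→ℚ (𝟙-no (i <? p ×-dec m ∸ suc i ℕ.≟ q) (not-met i i<m))))
                              (cong ℕ→ℚ (sym (𝟙-no (q <? m ×-dec m ≤? q ℕ.+ p) ¬crossing)))
    where
      not-met : ∀ i → i < m → ¬ (i < p × m ∸ suc i ≡ q)
      not-met i i<m (i<p , on) = ¬crossing
        ( subst (q <_) (sym m≡q+1+i) (ℕP.m<m+n q (s≤s z≤n))
        , subst (ℕ._≤ q ℕ.+ p) (sym m≡q+1+i) (ℕP.+-monoʳ-≤ q i<p) )
        where
          m≡q+1+i : m ≡ q ℕ.+ suc i
          m≡q+1+i = on-antidiagonal i<m on

  chain-diagonal : 1 ℕ.≤ n → ∀ p q m → m < k → diagSum (chain p q) m ≡ ℕ→ℚ (n ℕ.+ at α m)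
  chain-diagonal 1≤n p q m m<k = begin
    diagSum (chain p q) m                                               ≡⟨ sumTo-shift m (λ i → chain p q i (m ∸ i)) ⟩
    chain p q 0 m + sumTo m (λ i → chain p q (suc i) (m ∸ suc i))       ≡⟨ cong₂ _+_ row-zero (chain-crossings p q m) ⟩
    ℕ→ℚ (X ∸ C) + ℕ→ℚ C                                                 ≡⟨ ℕ→ℚ-+ (X ∸ C) C ⟨
    ℕ→ℚ (X ∸ C ℕ.+ C)                                                   ≡⟨ cong ℕ→ℚ (ℕP.m∸n+n≡m C≤X) ⟩
    ℕ→ℚ X                                                               ∎
    where
      open ≡-Reasoning
      X = n ℕ.+ at α m
      C = compensation p q m
      row-zero : chain p q 0 m ≡ ℕ→ℚ (X ∸ C)
      row-zero = cong ℕ→ℚ (trans (cong (ℕ._* (X ∸ C)) (𝟙-yes (m <? k) m<k)) (ℕP.*-identityˡ (X ∸ C)))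
      C≤X : C ℕ.≤ X
      C≤X = ℕP.≤-trans (𝟙≤1 (q <? m ×-dec m ≤? q ℕ.+ p)) (ℕP.≤-trans 1≤n (ℕP.m≤m+n n _))

  chain∈P : 1 ℕ.≤ n → ∀ p q → p ℕ.+ q < k → P k n α (chain p q)
  chain∈P 1≤n p q p+q<k =
    (λ i j k≤i+j → cong ℕ→ℚ (chain-outside p q i j p+q<k k≤i+j)) ,
    (λ i j _ → ℕ→ℚ-mono-≤ {0} {chainℕ p q i j} z≤n , ℕ→ℚ-mono-≤ (chain-bound 1≤n p q i j)) ,
    (λ i m _ → chain-rows 1≤n (ℕP.≤-<-trans z≤n p+q<k) p q i m) ,
    (λ m m<k → chain-diagonal 1≤n p q m m<k)

  chain-step : ∀ p q i j → chainℕ p q (suc i) j ≡ chainℕ p q (suc (suc i)) j ℕ.+ 𝟙 ((p , q) ≟₂ (suc i , j))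
  chain-step p q i j = begin
    𝟙 (i <? p ×-dec j ℕ.≟ q)                                  ≡⟨ 𝟙-× (i <? p) (j ℕ.≟ q) ⟩
    𝟙 (i <? p) ℕ.* Q                                          ≡⟨ cong (ℕ._* Q) (𝟙-<-step i p) ⟩
    (𝟙 (suc i <? p) ℕ.+ 𝟙 (p ℕ.≟ suc i)) ℕ.* Q                ≡⟨ ℕP.*-distribʳ-+ Q (𝟙 (suc i <? p)) (𝟙 (p ℕ.≟ suc i)) ⟩
    𝟙 (suc i <? p) ℕ.* Q ℕ.+ 𝟙 (p ℕ.≟ suc i) ℕ.* Q            ≡⟨ cong₂ ℕ._+_ (𝟙-× (suc i <? p) (j ℕ.≟ q)) (𝟙-× (p ℕ.≟ suc i) (j ℕ.≟ q)) ⟨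
    𝟙 (suc i <? p ×-dec j ℕ.≟ q) ℕ.+ 𝟙 (p ℕ.≟ suc i ×-dec j ℕ.≟ q)
      ≡⟨ cong (𝟙 (suc i <? p ×-dec j ℕ.≟ q) ℕ.+_)
              (𝟙-cong (p ℕ.≟ suc i ×-dec j ℕ.≟ q) ((p , q) ≟₂ (suc i , j))
                      (λ (p≡1+i , j≡q) → cong₂ _,_ p≡1+i (sym j≡q))
                      (λ end → cong proj₁ end , sym (cong proj₂ end))) ⟩
    𝟙 (suc i <? p ×-dec j ℕ.≟ q) ℕ.+ 𝟙 ((p , q) ≟₂ (suc i , j)) ∎
    where
      open ≡-Reasoning
      Q = 𝟙 (j ℕ.≟ q)

  chain-corner : ∀ p q i → p ℕ.+ q < suc (suc i) → (p , q) ≢ (suc i , 0) → chainℕ p q (suc i) 0 ≡ 0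
  chain-corner p q i p+q<2+i not-corner = 𝟙-no (i <? p ×-dec 0 ℕ.≟ q) ends-at-corner
    where
      ends-at-corner : ¬ (i < p × 0 ≡ q)
      ends-at-corner (i<p , refl) = not-corner (cong (_, 0) (ℕP.≤-antisym p≤1+i i<p))
        where
          p≤1+i : p ℕ.≤ suc i
          p≤1+i = ℕP.≤-pred (subst (_< suc (suc i)) (ℕP.+-identityʳ p) p+q<2+i)

  chainAt : ℕ × ℕ → Pt
  chainAt x = chain (proj₁ x) (proj₂ x)

  ending-at : ∀ {s} → (Fin s → ℚ) → (Fin s → ℕ × ℕ) → ℕ → ℕ → ℚ
  ending-at c keys i j = sum (λ t → c t * ℕ→ℚ (𝟙 (keys t ≟₂ (i , j))))

  combination-step : ∀ {s} (c : Fin s → ℚ) (keys : Fin s → ℕ × ℕ) i j →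
    combination c (chainAt ∘ keys) (suc i) j
      ≡ combination c (chainAt ∘ keys) (suc (suc i)) j + ending-at c keys (suc i) j
  combination-step c keys i j = trans (sum-cong-≗ (λ t → sym (step t)))
    (∑-distrib-+ (λ t → c t * chainAt (keys t) (suc (suc i)) j)
                 (λ t → c t * ℕ→ℚ (𝟙 (keys t ≟₂ (suc i , j)))))
    where
      step : ∀ t → c t * chainAt (keys t) (suc (suc i)) j + c t * ℕ→ℚ (𝟙 (keys t ≟₂ (suc i , j)))
                 ≡ c t * chainAt (keys t) (suc i) j
      step t = begin
        c t * ℕ→ℚ below + c t * ℕ→ℚ end  ≡⟨ ℚP.*-distribˡ-+ (c t) (ℕ→ℚ below) (ℕ→ℚ end) ⟨
        c t * (ℕ→ℚ below + ℕ→ℚ end)      ≡⟨ cong (c t *_) (ℕ→ℚ-+ below end) ⟨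
        c t * ℕ→ℚ (below ℕ.+ end)        ≡⟨ cong (λ e → c t * ℕ→ℚ e) (chain-step p q i j) ⟨
        c t * chainAt (keys t) (suc i) j ∎
        where
          open ≡-Reasoning
          p = proj₁ (keys t)
          q = proj₂ (keys t)
          below = chainℕ p q (suc (suc i)) j
          end = 𝟙 ((p , q) ≟₂ (suc i , j))

  chains-independent : (T : List (ℕ × ℕ)) → All (λ x → 1 ℕ.≤ proj₁ x) T → Unique ((0 , 0) ∷ T) →
    AffIndep (λ t → chainAt (lookup ((0 , 0) ∷ T) t))
  chains-independent T below-row-0 unique = sum→AffIndep (chainAt ∘ keys) all-zero
    where
      keys : Fin (suc (length T)) → ℕ × ℕ
      keys = lookup ((0 , 0) ∷ T)

      all-zero : AffIndep-sum (chainAt ∘ keys)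
      all-zero c Σc≡0 comb≡0 = c≡0
        where
          -- Both rows of `combination-step` vanish, hence so does every chain-end weight.
          no-chain-ends : ∀ i j → ending-at c keys (suc i) j ≡ 0ℚ
          no-chain-ends i j = begin
            ending-at c keys (suc i) j                                   ≡⟨ ℚP.+-identityˡ _ ⟨
            0ℚ + ending-at c keys (suc i) j                              ≡⟨ cong (_+ ending-at c keys (suc i) j) (comb≡0 (suc (suc i)) j) ⟨
            combination c (chainAt ∘ keys) (suc (suc i)) j + ending-at c keys (suc i) j
                                                                         ≡⟨ combination-step c keys i j ⟨
            combination c (chainAt ∘ keys) (suc i) j                     ≡⟨ comb≡0 (suc i) j ⟩
            0ℚ                                                           ∎
            where open ≡-Reasoning

          -- The key of chain point v is unique, so its weight is the weight
          -- of the chains ending there.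
          c-chain≡0 : ∀ v → c (Fin.suc v) ≡ 0ℚ
          c-chain≡0 v with lookup T v in key≡ | All.lookup below-row-0 (∈-lookup v)
          ... | (suc i , q) | _ = begin
            c (Fin.suc v)                                             ≡⟨ sum-marker _≟₂_ keys c (Fin.suc v) only-here ⟨
            sum (λ t → c t * ℕ→ℚ (𝟙 (keys t ≟₂ keys (Fin.suc v))))    ≡⟨ cong (λ key → sum (λ t → c t * ℕ→ℚ (𝟙 (keys t ≟₂ key)))) key≡ ⟩
            ending-at c keys (suc i) q                                ≡⟨ no-chain-ends i q ⟩
            0ℚ                                                        ∎
            where
              open ≡-Reasoning
              only-here : ∀ t → keys t ≡ keys (Fin.suc v) → t ≡ Fin.suc v
              only-here t = lookup-injective unique t (Fin.suc v)

          -- The weight of the base point then vanishes since Σ cₜ = 0.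
          c≡0 : ∀ t → c t ≡ 0ℚ
          c≡0 (Fin.suc v) = c-chain≡0 v
          c≡0 0F = begin
            c 0F                         ≡⟨ ℚP.+-identityʳ (c 0F) ⟨
            c 0F + 0ℚ                    ≡⟨ cong (c 0F +_) (sum-zero c-chain≡0) ⟨
            c 0F + sum (c ∘ Fin.suc)     ≡⟨ Σc≡0 ⟩
            0ℚ                           ∎
            where open ≡-Reasoning

  rank-from-keys : (S : Region) → S ⊆ P k n α → (T : List (ℕ × ℕ)) →
    All (λ x → 1 ℕ.≤ proj₁ x) T → Unique T → All (S ∘ chainAt) ((0 , 0) ∷ T) → Covers k S T →
    HasRank S (suc (length T))
  rank-from-keys S S⊆P T below-row-0 unique chains∈S covers =
    ( (chainAt ∘ lookup ((0 , 0) ∷ T))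
    , (λ t → All.lookup chains∈S (∈-lookup t))
    , chains-independent T below-row-0 (All.map origin-not-below below-row-0 ∷ unique) )
    , (λ ps ps∈S → affinely-dependent k n α S S⊆P T covers ℕP.≤-refl ps ps∈S)
    where
      origin-not-below : ∀ {x} → 1 ℕ.≤ proj₁ x → (0 , 0) ≢ x
      origin-not-below 1≤0 refl = ℕP.<-irrefl refl 1≤0

dot-single : ∀ N (c x : Pt) a b → a < N → b < N → (∀ i j → (i , j) ≢ (a , b) → c i j ≡ 0ℚ) →
  dot N c x ≡ c a b * x a b
dot-single N c x a b a<N b<N off-support =
  trans (sumTo-single N a a<N other-rows) (sumTo-single N b b<N other-columns)
  where
    other-rows : ∀ i → i < N → i ≢ a → sumTo N (λ j → c i j * x i j) ≡ 0ℚ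
    other-rows i _ i≢a = sumTo-zero N (λ j _ →
      trans (cong (_* x i j) (off-support i j (i≢a ∘ cong proj₁))) (ℚP.*-zeroˡ (x i j)))
    other-columns : ∀ j → j < N → j ≢ b → c a j * x a j ≡ 0ℚ
    other-columns j _ j≢b =
      trans (cong (_* x a j) (off-support a j (j≢b ∘ cong proj₂))) (ℚP.*-zeroˡ (x a j))

-- The coefficients of the functional A ↦ -a_{k,1} (0-based entry (k-1 , 0)).
minus-corner : ℕ → Pt
minus-corner k₀ i j = if does ((i , j) ≟₂ (k₀ , 0)) then - 1ℚ else 0ℚ

corner-face : ∀ k₀ n α → IsFace (P (suc k₀) n α) (ΔP (suc k₀) n α)
corner-face k₀ n α = suc k₀ , minus-corner k₀ , 0ℚ , valid , tight
  where
    k₀+0<k : k₀ ℕ.+ 0 < suc k₀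
    k₀+0<k = subst (_< suc k₀) (sym (ℕP.+-identityʳ k₀)) ℕP.≤-refl

    value : ∀ x → dot (suc k₀) (minus-corner k₀) x ≡ - x k₀ 0
    value x = begin
      dot (suc k₀) (minus-corner k₀) x  ≡⟨ dot-single (suc k₀) (minus-corner k₀) x k₀ 0 ℕP.≤-refl (s≤s z≤n) off-corner ⟩
      minus-corner k₀ k₀ 0 * x k₀ 0     ≡⟨ cong (_* x k₀ 0) at-corner ⟩
      - 1ℚ * x k₀ 0                     ≡⟨ ℚP.neg-distribˡ-* 1ℚ (x k₀ 0) ⟨
      - (1ℚ * x k₀ 0)                   ≡⟨ cong -_ (ℚP.*-identityˡ (x k₀ 0)) ⟩
      - x k₀ 0                          ∎
      where
        open ≡-Reasoning
        off-corner : ∀ i j → (i , j) ≢ (k₀ , 0) → minus-corner k₀ i j ≡ 0ℚ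
        off-corner i j ≢corner rewrite dec-false ((i , j) ≟₂ (k₀ , 0)) ≢corner = refl
        at-corner : minus-corner k₀ k₀ 0 ≡ - 1ℚ
        at-corner rewrite dec-true ((k₀ , 0) ≟₂ (k₀ , 0)) refl = refl

    valid : ∀ x → P (suc k₀) n α x → dot (suc k₀) (minus-corner k₀) x ≤ 0ℚ
    valid x x∈P = subst (_≤ 0ℚ) (sym (value x))
      (ℚP.neg-antimono-≤ (proj₁ (proj₁ (proj₂ x∈P) k₀ 0 k₀+0<k)))

    tight : ∀ x → ΔP (suc k₀) n α x ⇔ (P (suc k₀) n α x × dot (suc k₀) (minus-corner k₀) x ≡ 0ℚ)
    tight x = mk⇔ (λ (x∈P , corner≡0) → x∈P , trans (value x) (cong -_ corner≡0))
                  (λ (x∈P , dot≡0) → x∈P , ℚP.neg-injective (trans (sym (value x)) dot≡0))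

empty-rank : (S : Region) → (∀ x → ¬ S x) → HasRank S 0
empty-rank S empty = ((λ ()) , (λ ()) , (λ c _ _ ())) , (λ ps ps∈S → ⊥-elim (empty (ps 0F) (ps∈S 0F)))

-- For k = 1 the polytope is the single point a₁₁ = n + α₁ ≥ 1, so ΔP is empty.
ΔP₁-empty : ∀ n → 1 ℕ.≤ n → (α : Fin 1 → ℕ) → ∀ x → ¬ ΔP 1 n α x
ΔP₁-empty n 1≤n α x (x∈P , corner≡0) = ℕP.<⇒≢ 0<n+α₁ (ℕ→ℚ-injective (begin
  ℕ→ℚ 0                      ≡⟨ cong (0ℚ +_) corner≡0 ⟨
  0ℚ + x 0 0                 ≡⟨ proj₂ (proj₂ (proj₂ x∈P)) 0 (s≤s z≤n) ⟩
  ℕ→ℚ (n ℕ.+ at α 0)         ∎))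
  where
    open ≡-Reasoning
    0<n+α₁ : 0 < n ℕ.+ at α 0
    0<n+α₁ = ℕP.≤-trans 1≤n (ℕP.m≤m+n n _)

NonCornerFree : ℕ → ℕ × ℕ → Set
NonCornerFree k x = 1 ℕ.≤ proj₁ x × proj₁ x ℕ.+ proj₂ x < k × x ≢ (k ∸ 1 , 0)

nonCornerFree? : ∀ k x → Dec (NonCornerFree k x)
nonCornerFree? k x = (1 ≤? proj₁ x) ×-dec (proj₁ x ℕ.+ proj₂ x <? k) ×-dec ¬? (x ≟₂ (k ∸ 1 , 0))

nonCornerKeys : ℕ → List (ℕ × ℕ)
nonCornerKeys k = filter (nonCornerFree? k) (cartesianProduct (upTo k) (upTo k))

nonCornerKeys-complete : ∀ k p q → NonCornerFree k (p , q) → (p , q) ∈ nonCornerKeys k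
nonCornerKeys-complete k p q free@(_ , p+q<k , _) = ∈-filter⁺ (nonCornerFree? k)
  (∈-cartesianProduct⁺ (∈-upTo⁺ (ℕP.≤-<-trans (ℕP.m≤m+n p q) p+q<k))
                       (∈-upTo⁺ (ℕP.≤-<-trans (ℕP.m≤n+m q p) p+q<k)))
  free

nonCornerKeys-sound : ∀ k → All (NonCornerFree k) (nonCornerKeys k)
nonCornerKeys-sound k = All.tabulate (λ x∈keys →
  proj₂ (∈-filter⁻ (nonCornerFree? k) {xs = cartesianProduct (upTo k) (upTo k)} x∈keys))

nonCornerKeys-unique : ∀ k → Unique (nonCornerKeys k)
nonCornerKeys-unique k = UniqueP.filter⁺ (nonCornerFree? k)
  (UniqueP.cartesianProduct⁺ (UniqueP.upTo⁺ k) (UniqueP.upTo⁺ k))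

module TwoOrMoreRows (k′ n : ℕ) (1≤n : 1 ℕ.≤ n) (α : Fin (suc (suc k′)) → ℕ) where

  k : ℕ
  k = suc (suc k′)
  open ChainPoints k n α

  corner : ℕ × ℕ
  corner = (suc k′ , 0)

  keys : List (ℕ × ℕ)
  keys = nonCornerKeys k

  corner<k : suc k′ ℕ.+ 0 < k
  corner<k = subst (_< k) (sym (ℕP.+-identityʳ (suc k′))) ℕP.≤-refl

  chain∈ΔP : ∀ p q → p ℕ.+ q < k → (p , q) ≢ corner → ΔP k n α (chain p q)
  chain∈ΔP p q p+q<k ≢corner = chain∈P 1≤n p q p+q<k , cong ℕ→ℚ (chain-corner p q k′ p+q<k ≢corner)

  keys-inside : All (λ x → proj₁ x ℕ.+ proj₂ x < k) keys
  keys-inside = All.map (proj₁ ∘ proj₂) (nonCornerKeys-sound k)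

  rank-P : HasRank (P k n α) (suc (suc (length keys)))
  rank-P = rank-from-keys (P k n α) (λ x∈P → x∈P) (corner ∷ keys)
    (s≤s z≤n ∷ All.map proj₁ (nonCornerKeys-sound k))
    (All.map (λ (_ , _ , x≢corner) corner≡x → x≢corner (sym corner≡x)) (nonCornerKeys-sound k)
      ∷ nonCornerKeys-unique k)
    (chain∈P 1≤n 0 0 (s≤s z≤n) ∷ chain∈P 1≤n (suc k′) 0 corner<k
      ∷ All.map (chain∈P 1≤n _ _) keys-inside)
    covers
    where
      covers : Covers k (P k n α) (corner ∷ keys)
      covers p q 1≤p p+q<k with (p , q) ≟₂ corner
      ... | yes is-corner  = inj₁ (here is-corner)
      ... | no  not-corner = inj₁ (there (nonCornerKeys-complete k p q (1≤p , p+q<k , not-corner)))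

  rank-ΔP : HasRank (ΔP k n α) (suc (length keys))
  rank-ΔP = rank-from-keys (ΔP k n α) proj₁ keys
    (All.map proj₁ (nonCornerKeys-sound k))
    (nonCornerKeys-unique k)
    (chain∈ΔP 0 0 (s≤s z≤n) (λ ()) ∷ All.map (λ (_ , p+q<k , ≢corner) → chain∈ΔP _ _ p+q<k ≢corner)
                                             (nonCornerKeys-sound k))
    covers
    where
      covers : Covers k (ΔP k n α) keys
      covers p q 1≤p p+q<k with (p , q) ≟₂ corner
      ... | yes refl       = inj₂ (λ x (_ , corner≡0) → corner≡0)
      ... | no  not-corner = inj₁ (nonCornerKeys-complete k p q (1≤p , p+q<k , not-corner))

mainTheorem6 : (k : ℕ) → 1 ℕ.≤ k → (n : ℕ) → 1 ℕ.≤ n →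
    (α : Fin k → ℕ) → Antitone α →
    IsFacet (P k n α) (ΔP k n α)
mainTheorem6 zero () n 1≤n α _
mainTheorem6 (suc zero) _ n 1≤n α _ =
  corner-face 0 n α , 0 , rank-P , empty-rank (ΔP 1 n α) (ΔP₁-empty n 1≤n α)
  where
    open ChainPoints 1 n α
    rank-P : HasRank (P 1 n α) 1
    rank-P = rank-from-keys (P 1 n α) (λ x∈P → x∈P) [] [] [] (chain∈P 1≤n 0 0 (s≤s z≤n) ∷ [])
      (λ p q 1≤p p+q<1 → ⊥-elim (ℕP.<⇒≱ p+q<1 (ℕP.≤-trans 1≤p (ℕP.m≤m+n p q))))
mainTheorem6 (suc (suc k′)) _ n 1≤n α _ =
  corner-face (suc k′) n α , suc (length keys) , rank-P , rank-ΔP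
  where open TwoOrMoreRows k′ n 1≤n α
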